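{- Let $\hat\Sigma,\Sigma,\Sigma'$ be spatial conjunctions with $\Sigma\subseteq\hat\Sigma$ (as multisets), and let $s$ be a stack with $s\models\mathrm{WellFormed}(\hat\Sigma)$. Let $U$ be the pure formula returned by $\mathrm{Match}(s,\hat\Sigma,\Sigma,\Sigma')$. Then: (i) if $s\models U$, the formula $U\land\hat\Sigma\rightarrow(\hat\Sigma\setminus\Sigma)\ast\Sigma'$ is valid; and (ii) if $s\not\models U$, there is a heap $h$ such that $s,h\not\models\hat\Sigma\rightarrow(\hat\Sigma\setminus\Sigma)\ast\Sigma'$, i.e. $s,h\models\hat\Sigma$ and $s,h\not\models(\hat\Sigma\setminus\Sigma)\ast\Sigma'$.
   Context: Setting: a many-sorted first-order language with sorts including $\mathsf{Int}$ and $\mathsf{Bool}$, equality $\simeq$, classical boolean connectives, and possibly further theory symbols with standard interpretations. Pure = containing no spatial symbol. A stack $s$ maps variables to values of their sorts and is extended to pure expressions. A heap is a partial function $h\colon\mathbb{Z}\rightharpoonup\mathsf{Val}$; $h=h_1\ast\dots\ast h_n$ means $h$ is the union of the $h_i$ with pairwise disjoint domains. Spatial predicates: $\mathrm{emp}$, $\mathrm{next}(x,y)$, $\mathrm{lseg}(x,y)$ with $x,y$ pure $\mathsf{Int}$ expressions. A spatial conjunction $\Sigma=S_1\ast\dots\ast S_n$ ($n\ge0$) is a finite multiset of spatial predicates; $\subseteq$, $\in$, $\setminus$ (multiset difference; $\Sigma\setminus S$ removes one occurrence) and $\ast$ (multiset union) are multiset operations; the empty conjunction denotes $\mathrm{emp}$.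 Semantics: $s,h\models\Pi$ (pure) iff $s(\Pi)=\top$; $s,h\models\mathrm{emp}$ iff $h=\emptyset$; $s,h\models\mathrm{next}(x,y)$ iff $h=\{s(x)\mapsto s(y)\}$; $s,h\models F_1\ast F_2$ iff $h=h_1\ast h_2$ with $s,h_i\models F_i$; $s,h\models\mathrm{lseg}(x,z)$ iff there are $n\ge0$ and integers $a_0,\dots,a_n$ with $a_0=s(x)$, $a_n=s(z)$, $a_i\ne s(z)$ for $i<n$ and $h=\{a_0\mapsto a_1\}\ast\dots\ast\{a_{n-1}\mapsto a_n\}$; $\land,\lnot,\rightarrow$ classical. A formula is valid if satisfied by every pair $(s,h)$; $s\models F$ means $s,h\models F$ for all heaps $h$. Auxiliary definitions: $\mathrm{Empty}(\mathrm{emp})=\top$, $\mathrm{Empty}(\mathrm{next}(x,y))=\bot$, $\mathrm{Empty}(\mathrm{lseg}(x,y))=(x\simeq y)$; $\mathrm{Addr}(\mathrm{next}(x,y))=\mathrm{Addr}(\mathrm{lseg}(x,y))=x$. $\mathrm{Collide}(S,S')=\lnot\mathrm{Empty}(S)\land\lnot\mathrm{Empty}(S')\land\mathrm{Addr}(S)\simeq\mathrm{Addr}(S')$ ($\bot$ if either is $\mathrm{emp}$). $\mathrm{WellFormed}(S_1\ast\dots\ast S_n)=\bigwedge_{1\le i<j\le n}\lnot\mathrm{Collide}(S_i,S_j)$. $\mathrm{Alloc}(S_1\ast\dots\ast S_n,x)=\bigvee_i(\lnot\mathrm{Empty}(S_i)\land x\simeq\mathrm{Addr}(S_i))$. For $S\in\{\mathrm{next}(x,y),\mathrm{lseg}(x,y)\}$,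 $S'\in\{\mathrm{next}(x',z),\mathrm{lseg}(x',z)\}$, $\mathrm{Update}(S,S')$ and $\mathrm{Check}(\hat\Sigma,S,S')$ are: $(\mathrm{next}(x,y),\mathrm{next}(x',z))$: $\mathrm{emp}$, $y\simeq z$; $(\mathrm{next}(x,y),\mathrm{lseg}(x',z))$: $\mathrm{lseg}(y,z)$, $\top$; $(\mathrm{lseg}(x,y),\mathrm{next}(x',z))$: $\mathrm{emp}$, $\bot$; $(\mathrm{lseg}(x,y),\mathrm{lseg}(x',z))$: $\mathrm{lseg}(y,z)$, $y\not\simeq z\rightarrow\mathrm{Alloc}(\hat\Sigma,z)$. $\mathrm{Guard}(\hat\Sigma,S,S')=\mathrm{Collide}(S,S')\land\mathrm{Check}(\hat\Sigma,S,S')$ ($\bot$ if $S$ or $S'$ is $\mathrm{emp}$). $\mathrm{Match}(s,\hat\Sigma,\Sigma,\Sigma')$ returns a pure formula (each "there is" picks an arbitrary witness): 1. if there is $S\in\Sigma$ with $s\models\mathrm{Empty}(S)$, return $\mathrm{Empty}(S)\land\mathrm{Match}(s,\hat\Sigma,\Sigma\setminus S,\Sigma')$; 2. else if there is $S'\in\Sigma'$ with $s\models\mathrm{Empty}(S')$, return $\mathrm{Empty}(S')\land\mathrm{Match}(s,\hat\Sigma,\Sigma,\Sigma'\setminus S')$; 3. else if there are $S\in\Sigma$, $S'\in\Sigma'$ with $s\models\mathrm{Guard}(\hat\Sigma,S,S')$, return $\mathrm{Guard}(\hat\Sigma,S,S')\land\mathrm{Match}(s,\hat\Sigma,\Sigma\setminus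 S,(\Sigma'\setminus S')\ast\mathrm{Update}(S,S'))$; 4. else return $\top$ if $\Sigma$ and $\Sigma'$ are both empty and $\bot$ otherwise. -}

module Defs where

open import Data.Integer using (ℤ)
open import Data.Maybe using (Maybe; just; nothing)
open import Data.List using (List; []; _∷_; _++_)
open import Data.List.Membership.Propositional using (_∈_)
open import Data.Product using (_×_; Σ; ∃; _,_)
open import Data.Sum using (_⊎_)
open import Data.Unit using (⊤)
open import Data.Empty using (⊥)
open import Relation.Nullary using (¬_)
open import Relation.Binary.PropositionalEquality using (_≡_; _≢_)

record PureLang : Set₁ where
  field
    Stack : Set
    Expr  : Set
    eval  : Expr → Stack → ℤ

module SL (L : PureLang) where
  open PureLang L public

  infixr 6 _∧ₚ_
  data PF : Set where
    ⊤ₚ ⊥ₚ : PF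
    _≃_   : Expr → Expr → PF
    ¬ₚ_   : PF → PF
    _∧ₚ_ _∨ₚ_ _⇒ₚ_ : PF → PF → PF

  _⊨ₚ_ : Stack → PF → Set
  s ⊨ₚ ⊤ₚ = ⊤
  s ⊨ₚ ⊥ₚ = ⊥
  s ⊨ₚ (x ≃ y) = eval x s ≡ eval y s
  s ⊨ₚ (¬ₚ P) = ¬ (s ⊨ₚ P)
  s ⊨ₚ (P ∧ₚ Q) = (s ⊨ₚ P) × (s ⊨ₚ Q)
  s ⊨ₚ (P ∨ₚ Q) = (s ⊨ₚ P) ⊎ (s ⊨ₚ Q)
  s ⊨ₚ (P ⇒ₚ Q) = (s ⊨ₚ P) → (s ⊨ₚ Q)

  -- Spatial predicates and spatial conjunctions (multisets as lists)
  data SP : Set where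
    emp  : SP
    next : Expr → Expr → SP
    lseg : Expr → Expr → SP

  SpConj : Set
  SpConj = List SP

  Heap : Set
  Heap = ℤ → Maybe ℤ

  EmptyHeap : Heap → Set
  EmptyHeap h = ∀ a → h a ≡ nothing

  PointsTo : ℤ → ℤ → Heap → Set
  PointsTo a b h = (h a ≡ just b) × (∀ c → c ≢ a → h c ≡ nothing)

  -- h = h₁ ∗ h₂ (union with disjoint domains)
  Split : Heap → Heap → Heap → Set
  Split h h₁ h₂ = ∀ a → ((h₁ a ≡ nothing) × (h a ≡ h₂ a)) ⊎ ((h₂ a ≡ nothing) × (h a ≡ h₁ a))

  -- LsegH a z h : there are a₀ = a, …, aₙ = z with aᵢ ≠ z for i < n and
  -- h = {a₀ ↦ a₁} ∗ … ∗ {aₙ₋₁ ↦ aₙ}   (inductive unfolding on n)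
  data LsegH (z : ℤ) : ℤ → Heap → Set where
    done : ∀ {h} → EmptyHeap h → LsegH z z h
    step : ∀ {a b h h₁ h₂} → a ≢ z → Split h h₁ h₂ → PointsTo a b h₁ →
           LsegH z b h₂ → LsegH z a h

  infixr 5 _∗_
  infixr 4 _∧_
  infixr 3 _⇒_
  data Form : Set where
    pure      : PF → Form
    spat      : SP → Form
    _∗_ _∧_ _⇒_ : Form → Form → Form
    ¬f_       : Form → Form

  _,_⊨_ : Stack → Heap → Form → Set
  s , h ⊨ pure P = s ⊨ₚ P
  s , h ⊨ spat emp = EmptyHeap h
  s , h ⊨ spat (next x y) = PointsTo (eval x s) (eval y s) h
  s , h ⊨ spat (lseg x z) = LsegH (eval z s) (eval x s) h
  s , h ⊨ (F ∗ G) = ∃ λ h₁ → ∃ λ h₂ → Split h h₁ h₂ × (s , h₁ ⊨ F) × (s , h₂ ⊨ G)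
  s , h ⊨ (F ∧ G) = (s , h ⊨ F) × (s , h ⊨ G)
  s , h ⊨ (F ⇒ G) = (s , h ⊨ F) → (s , h ⊨ G)
  s , h ⊨ (¬f F) = ¬ (s , h ⊨ F)

  Valid : Form → Set
  Valid F = ∀ s h → s , h ⊨ F

  ⟦_⟧ : SpConj → Form
  ⟦ [] ⟧ = spat emp
  ⟦ S ∷ [] ⟧ = spat S
  ⟦ S ∷ Σ₁@(_ ∷ _) ⟧ = spat S ∗ ⟦ Σ₁ ⟧

  Empty : SP → PF
  Empty emp = ⊤ₚ
  Empty (next x y) = ⊥ₚ
  Empty (lseg x y) = x ≃ y

  Collide : SP → SP → PF
  Collide emp S' = ⊥ₚ
  Collide (next _ _) emp = ⊥ₚ
  Collide (lseg _ _) emp = ⊥ₚ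
  Collide S@(next x _) S'@(next x' _) = ¬ₚ Empty S ∧ₚ ¬ₚ Empty S' ∧ₚ x ≃ x'
  Collide S@(next x _) S'@(lseg x' _) = ¬ₚ Empty S ∧ₚ ¬ₚ Empty S' ∧ₚ x ≃ x'
  Collide S@(lseg x _) S'@(next x' _) = ¬ₚ Empty S ∧ₚ ¬ₚ Empty S' ∧ₚ x ≃ x'
  Collide S@(lseg x _) S'@(lseg x' _) = ¬ₚ Empty S ∧ₚ ¬ₚ Empty S' ∧ₚ x ≃ x'

  NoCollideWith : SP → SpConj → PF
  NoCollideWith S [] = ⊤ₚ
  NoCollideWith S (T ∷ Σ₁) = ¬ₚ Collide S T ∧ₚ NoCollideWith S Σ₁

  WellFormed : SpConj → PF
  WellFormed [] = ⊤ₚ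
  WellFormed (S ∷ Σ₁) = NoCollideWith S Σ₁ ∧ₚ WellFormed Σ₁

  -- one disjunct ¬Empty(S) ∧ x ≃ Addr(S); for S = emp it is ⊥ (¬Empty(emp) = ⊥)
  AllocOne : SP → Expr → PF
  AllocOne emp x = ⊥ₚ
  AllocOne S@(next a _) x = ¬ₚ Empty S ∧ₚ x ≃ a
  AllocOne S@(lseg a _) x = ¬ₚ Empty S ∧ₚ x ≃ a

  Alloc : SpConj → Expr → PF
  Alloc [] x = ⊥ₚ
  Alloc (S ∷ Σ₁) x = AllocOne S x ∨ₚ Alloc Σ₁ x

  -- Update(S,S'); the emp cases never arise (Guard is ⊥ there)
  Update : SP → SP → SP
  Update (next x y) (next x' z) = emp
  Update (next x y) (lseg x' z) = lseg y z
  Update (lseg x y) (next x' z) = emp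
  Update (lseg x y) (lseg x' z) = lseg y z
  Update _ _ = emp

  Check : SpConj → SP → SP → PF
  Check Σ̂ (next x y) (next x' z) = y ≃ z
  Check Σ̂ (next x y) (lseg x' z) = ⊤ₚ
  Check Σ̂ (lseg x y) (next x' z) = ⊥ₚ
  Check Σ̂ (lseg x y) (lseg x' z) = (¬ₚ (y ≃ z)) ⇒ₚ Alloc Σ̂ z
  Check Σ̂ _ _ = ⊥ₚ

  Guard : SpConj → SP → SP → PF
  Guard Σ̂ emp S' = ⊥ₚ
  Guard Σ̂ (next _ _) emp = ⊥ₚ
  Guard Σ̂ (lseg _ _) emp = ⊥ₚ
  Guard Σ̂ S S' = Collide S S' ∧ₚ Check Σ̂ S S'

  -- Pick S Σ R : S is one occurrence in Σ and R = Σ ∖ S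
  data Pick : SP → SpConj → SpConj → Set where
    here  : ∀ {S Σ₁} → Pick S (S ∷ Σ₁) Σ₁
    there : ∀ {S T Σ₁ R} → Pick S Σ₁ R → Pick S (T ∷ Σ₁) (T ∷ R)

  Final : SpConj → SpConj → PF
  Final [] [] = ⊤ₚ
  Final _ _ = ⊥ₚ

  -- Match s Σ̂ Σ Σ' U : U is a possible result of Match(s, Σ̂, Σ, Σ')
  -- (all possible choices of the arbitrary witnesses).
  data Match (s : Stack) (Σ̂ : SpConj) : SpConj → SpConj → PF → Set where
    m1 : ∀ {Σ₁ Σ' S R U} → Pick S Σ₁ R → s ⊨ₚ Empty S →
         Match s Σ̂ R Σ' U → Match s Σ̂ Σ₁ Σ' (Empty S ∧ₚ U)
    m2 : ∀ {Σ₁ Σ' S' R' U} →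
         (∀ S → S ∈ Σ₁ → ¬ (s ⊨ₚ Empty S)) →
         Pick S' Σ' R' → s ⊨ₚ Empty S' →
         Match s Σ̂ Σ₁ R' U → Match s Σ̂ Σ₁ Σ' (Empty S' ∧ₚ U)
    m3 : ∀ {Σ₁ Σ' S S' R R' U} →
         (∀ T → T ∈ Σ₁ → ¬ (s ⊨ₚ Empty T)) →
         (∀ T' → T' ∈ Σ' → ¬ (s ⊨ₚ Empty T')) →
         Pick S Σ₁ R → Pick S' Σ' R' → s ⊨ₚ Guard Σ̂ S S' →
         Match s Σ̂ R (R' ++ (Update S S' ∷ [])) U →
         Match s Σ̂ Σ₁ Σ' (Guard Σ̂ S S' ∧ₚ U)
    m4 : ∀ {Σ₁ Σ'} →
         (∀ T → T ∈ Σ₁ → ¬ (s ⊨ₚ Empty T)) →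
         (∀ T' → T' ∈ Σ' → ¬ (s ⊨ₚ Empty T')) →
         (∀ T T' → T ∈ Σ₁ → T' ∈ Σ' → ¬ (s ⊨ₚ Guard Σ̂ T T')) →
         Match s Σ̂ Σ₁ Σ' (Final Σ₁ Σ')

-- Soundness: every step of Match removes a predicate that is empty under U, or replaces a pair
-- S ∈ Σ, S' ∈ Σ' satisfying Guard by Update(S, S'), and under Guard S ∗ Update(S, S') entails S'.
-- For list segments, lseg(x, y) ∗ lseg(y, z) entails lseg(x, z) once z lies outside the first
-- segment: Check makes z an address of Σ̂ (unless y = z), and the heap being matched owns no
-- address of Σ̂ besides those of its own predicates.
-- Completeness: if U fails, a counter-model is built by induction on the run of Match. Where Match
-- got stuck, either an address is allocated on one side only, or a predicate T of Σ collides with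
-- the head S' of Σ' although Guard(T, S') fails; T is then realised so that S' fails: by its single
-- cell, or, for a segment lseg(x, y), by a detour x ↦ m ↦ y through an address m not allocated by Σ̂.
-- All other predicates get their canonical one-cell models, and a step that matched a guarded pair
-- is undone by adding back the cell that Update consumed. Finally Σ̂ ∖ Σ is precise, so the
-- counter-model for Σ extends to Σ̂.

module Submission where

open import Defs
open import Data.Empty using (⊥; ⊥-elim)
open import Data.Integer as ℤ using (ℤ; +_)
open import Data.List as List using (List; []; _∷_; _++_; length)
open import Data.List.Extrema.Nat using (max; xs≤max)
open import Data.List.Membership.Propositional using (_∈_)
open import Data.List.Membership.Propositional.Properties using (∈-map⁺)
open import Data.List.Relation.Binary.Permutation.Propositional
  using (_↭_; prep; swap; ↭-sym) renaming (refl to ↭-refl; trans to ↭-trans)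
open import Data.List.Relation.Binary.Permutation.Propositional.Properties using (All-resp-↭; Any-resp-↭)
open import Data.List.Relation.Unary.All as All using (All; []; _∷_)
import Data.List.Relation.Unary.All.Properties as Allₚ
open import Data.List.Relation.Unary.AllPairs using (AllPairs; []; _∷_)
open import Data.List.Relation.Unary.Any as Any using (Any; here; there)
import Data.List.Relation.Unary.Any.Properties as Anyₚ
open import Data.Maybe using (Maybe; just; nothing; _<∣>_)
open import Data.Maybe.Properties using (<∣>-identityʳ; <∣>-assoc; ≡-dec)
open import Data.Nat using (zero; suc)
open import Data.Nat.Properties using (1+n≢0; 1+n≰n; suc-injective)
open import Data.Product as Product using (_×_; ∃; _,_; proj₁; proj₂)
open import Data.Sum as Sum using (_⊎_; inj₁; inj₂; [_,_]′)
open import Data.Unit using (tt)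
open import Function using (_∘_; id)
open import Relation.Binary.PropositionalEquality using (_≡_; _≢_; refl; sym; trans; cong; subst; subst₂)
open import Relation.Nullary using (¬_; Dec; yes; no; ¬?)
open import Relation.Nullary.Decidable as Dec using (_×-dec_)
open import Relation.Unary using (_⊆′_)

module Matching (L : PureLang) where
  open SL L

  -- Heaps

  infix 4 _≐_ _⊑_ _∈dom_
  infixr 6 _∪_
  infix 7 _↦_

  _≐_ : Heap → Heap → Set
  h ≐ h' = ∀ a → h a ≡ h' a

  _⊑_ : Heap → Heap → Set
  h ⊑ h' = ∀ a {v} → h a ≡ just v → h' a ≡ just v

  _∈dom_ : ℤ → Heap → Set
  a ∈dom h = ∃ λ v → h a ≡ just v

  Disjoint : Heap → Heap → Set
  Disjoint h₁ h₂ = ∀ a → h₁ a ≡ nothing ⊎ h₂ a ≡ nothing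

  ∅ : Heap
  ∅ _ = nothing

  _∪_ : Heap → Heap → Heap
  (h₁ ∪ h₂) a = h₁ a <∣> h₂ a

  _↦_ : ℤ → ℤ → Heap
  (a ↦ b) c with a ℤ.≟ c
  ... | yes _ = just b
  ... | no _ = nothing

  nothing≢just : ∀ {m : Maybe ℤ} {v} → m ≡ nothing → m ≡ just v → ⊥
  nothing≢just refl ()

  just-unique : ∀ {m : Maybe ℤ} {v w} → m ≡ just v → m ≡ just w → v ≡ w
  just-unique refl refl = refl

  ≐-sym : ∀ {h h'} → h ≐ h' → h' ≐ h
  ≐-sym e a = sym (e a)

  ≐-trans : ∀ {h h' h''} → h ≐ h' → h' ≐ h'' → h ≐ h''
  ≐-trans e e' a = trans (e a) (e' a)

  ⊑-trans : ∀ {h h' h''} → h ⊑ h' → h' ⊑ h'' → h ⊑ h''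
  ⊑-trans p q a e = q a (p a e)

  ⊑-nothing : ∀ {h h'} → h ⊑ h' → ∀ {a} → h' a ≡ nothing → h a ≡ nothing
  ⊑-nothing {h} p {a} n with h a in e
  ... | nothing = refl
  ... | just _ = ⊥-elim (nothing≢just n (p a e))

  ∅-empty : EmptyHeap ∅
  ∅-empty _ = refl

  ∅-⊑ : ∀ {h} → ∅ ⊑ h
  ∅-⊑ _ ()

  EmptyHeap-cong : ∀ {h h'} → h ≐ h' → EmptyHeap h → EmptyHeap h'
  EmptyHeap-cong e ε a = trans (sym (e a)) (ε a)

  ∪-cong : ∀ {h₁ h₂ h₁' h₂'} → h₁ ≐ h₁' → h₂ ≐ h₂' → h₁ ∪ h₂ ≐ h₁' ∪ h₂'
  ∪-cong e₁ e₂ a rewrite e₁ a | e₂ a = refl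

  ∪-just : ∀ {h₁ h₂ a v} → h₁ a ≡ just v → (h₁ ∪ h₂) a ≡ just v
  ∪-just e rewrite e = refl

  ∪-nothing : ∀ {h₁ h₂ a} → h₁ a ≡ nothing → (h₁ ∪ h₂) a ≡ h₂ a
  ∪-nothing e rewrite e = refl

  ∪-comm : ∀ {h₁ h₂} → Disjoint h₁ h₂ → h₁ ∪ h₂ ≐ h₂ ∪ h₁
  ∪-comm {h₁} {h₂} d a with h₁ a | h₂ a | d a
  ... | nothing | nothing | _      = refl
  ... | nothing | just _  | _      = refl
  ... | just _  | nothing | _      = refl
  ... | just _  | just _  | inj₁ ()
  ... | just _  | just _  | inj₂ ()

  ↦-here : ∀ a b → (a ↦ b) a ≡ just b
  ↦-here a b with a ℤ.≟ a
  ... | yes _ = refl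
  ... | no a≢a = ⊥-elim (a≢a refl)

  ↦-else : ∀ {a b c} → c ≢ a → (a ↦ b) c ≡ nothing
  ↦-else {a} {c = c} c≢a with a ℤ.≟ c
  ... | yes a≡c = ⊥-elim (c≢a (sym a≡c))
  ... | no _ = refl

  ↦-dom : ∀ {a b c v} → (a ↦ b) c ≡ just v → a ≡ c
  ↦-dom {a} {c = c} e with a ℤ.≟ c
  ... | yes a≡c = a≡c
  ... | no _ = ⊥-elim (nothing≢just refl e)

  ↦-PointsTo : ∀ a b → PointsTo a b (a ↦ b)
  ↦-PointsTo a b = ↦-here a b , λ _ → ↦-else

  PointsTo⇒≐↦ : ∀ {a b h} → PointsTo a b h → h ≐ a ↦ b
  PointsTo⇒≐↦ {a} {b} (ha , else) c with c ℤ.≟ a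
  ... | yes refl = trans ha (sym (↦-here a b))
  ... | no c≢a = trans (else c c≢a) (sym (↦-else c≢a))

  PointsTo-cong : ∀ {a b h h'} → h ≐ h' → PointsTo a b h → PointsTo a b h'
  PointsTo-cong e (ha , else) = trans (sym (e _)) ha , λ c c≢a → trans (sym (e c)) (else c c≢a)

  ↦-disjoint : ∀ {a b h} → h a ≡ nothing → Disjoint (a ↦ b) h
  ↦-disjoint {a} ha c with c ℤ.≟ a
  ... | yes refl = inj₂ ha
  ... | no c≢a = inj₁ (↦-else c≢a)

  split-comm : ∀ {h h₁ h₂} → Split h h₁ h₂ → Split h h₂ h₁
  split-comm sp a = Sum.swap (sp a)

  split-cong : ∀ {h h' h₁ h₂} → h ≐ h' → Split h h₁ h₂ → Split h' h₁ h₂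
  split-cong e sp a = Sum.map (Product.map₂ (trans (sym (e a)))) (Product.map₂ (trans (sym (e a)))) (sp a)

  split-congˡ : ∀ {h h₁ h₁' h₂} → h₁ ≐ h₁' → Split h h₁ h₂ → Split h h₁' h₂
  split-congˡ e sp a = Sum.map (Product.map₁ (trans (sym (e a)))) (Product.map₂ (λ q → trans q (e a))) (sp a)

  split-⊑ˡ : ∀ {h h₁ h₂} → Split h h₁ h₂ → h₁ ⊑ h
  split-⊑ˡ sp a e with sp a
  ... | inj₁ (n , _) = ⊥-elim (nothing≢just n e)
  ... | inj₂ (_ , q) = trans q e

  split-⊑ʳ : ∀ {h h₁ h₂} → Split h h₁ h₂ → h₂ ⊑ h
  split-⊑ʳ sp = split-⊑ˡ (split-comm sp)

  split-disjoint : ∀ {h h₁ h₂} → Split h h₁ h₂ → Disjoint h₁ h₂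
  split-disjoint sp a = Sum.map proj₁ proj₁ (sp a)

  split-apartˡ : ∀ {h h₁ h₂ a v} → Split h h₁ h₂ → h₁ a ≡ just v → h₂ a ≡ nothing
  split-apartˡ {a = a} sp e with sp a
  ... | inj₁ (n , _) = ⊥-elim (nothing≢just n e)
  ... | inj₂ (n , _) = n

  split-outˡ : ∀ {h h₁ h₂ a} → Split h h₁ h₂ → h₁ a ≡ nothing → h a ≡ h₂ a
  split-outˡ {a = a} sp n with sp a
  ... | inj₁ (_ , e) = e
  ... | inj₂ (n₂ , e) = trans e (trans n (sym n₂))

  split-∅ : ∀ {h} → Split h ∅ h
  split-∅ _ = inj₁ (refl , refl)

  split-emptyˡ : ∀ {h h₁ h₂} → EmptyHeap h₁ → Split h h₁ h₂ → h ≐ h₂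
  split-emptyˡ ε sp a = split-outˡ sp (ε a)

  split-∪ : ∀ {h₁ h₂} → Disjoint h₁ h₂ → Split (h₁ ∪ h₂) h₁ h₂
  split-∪ {h₁} d a with h₁ a | d a
  ... | nothing | _ = inj₁ (refl , refl)
  ... | just _  | inj₂ n = inj₂ (n , refl)

  split⇒≐∪ : ∀ {h h₁ h₂} → Split h h₁ h₂ → h ≐ h₁ ∪ h₂
  split⇒≐∪ {h₁ = h₁} {h₂} sp a with sp a
  ... | inj₁ (n , e) = trans e (sym (∪-nothing {h₁} {h₂} n))
  ... | inj₂ (n , e) = trans e (trans (sym (<∣>-identityʳ (h₁ a))) (cong (h₁ a <∣>_) (sym n)))

  split-cancelˡ : ∀ {h h₁ h₂ h₁' h₂'} → Split h h₁ h₂ → Split h h₁' h₂' → h₁ ≐ h₁' → h₂ ≐ h₂'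
  split-cancelˡ sp sp' e a with sp a | sp' a
  ... | inj₁ (n , q) | _ = trans (sym q) (split-outˡ sp' (trans (sym (e a)) n))
  ... | inj₂ (n , q) | inj₁ (n' , q') = trans n (trans (sym n') (trans (sym (e a)) (trans (sym q) q')))
  ... | inj₂ (n , _) | inj₂ (n' , _) = trans n (sym n')

  disjoint-⊑ʳ : ∀ {h₁ h₂ h₃} → Disjoint h₁ h₂ → h₃ ⊑ h₂ → Disjoint h₁ h₃
  disjoint-⊑ʳ d p a = Sum.map₂ (⊑-nothing p) (d a)

  disjoint-∪ˡ : ∀ {h₁ h₂ h₃} → Disjoint h₁ h₃ → Disjoint h₂ h₃ → Disjoint (h₁ ∪ h₂) h₃
  disjoint-∪ˡ {h₁} {h₂} d₁ d₂ a with d₁ a | d₂ a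
  ... | inj₂ n | _ = inj₂ n
  ... | inj₁ n | inj₂ n' = inj₂ n'
  ... | inj₁ n | inj₁ n' = inj₁ (trans (∪-nothing {h₁} {h₂} n) n')

  ≐∪⇒split : ∀ {h h₁ h₂} → Disjoint h₁ h₂ → h ≐ h₁ ∪ h₂ → Split h h₁ h₂
  ≐∪⇒split d e = split-cong (≐-sym e) (split-∪ d)

  split-assocˡ : ∀ {h h₁ h₂₃ h₂ h₃} → Split h h₁ h₂₃ → Split h₂₃ h₂ h₃ →
                 Split h (h₁ ∪ h₂) h₃ × Split (h₁ ∪ h₂) h₁ h₂
  split-assocˡ {h} {h₁} {h₂₃} {h₂} {h₃} sp sp' =
    ≐∪⇒split (disjoint-∪ˡ (disjoint-⊑ʳ d (split-⊑ʳ sp')) (split-disjoint sp')) h≐ ,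
    split-∪ (disjoint-⊑ʳ d (split-⊑ˡ sp'))
    where
    d : Disjoint h₁ h₂₃
    d = split-disjoint sp
    h≐ : h ≐ (h₁ ∪ h₂) ∪ h₃
    h≐ a = trans (split⇒≐∪ sp a)
             (trans (cong (h₁ a <∣>_) (split⇒≐∪ sp' a)) (sym (<∣>-assoc (h₁ a) (h₂ a) (h₃ a))))

  split-assocʳ : ∀ {h h₁₂ h₁ h₂ h₃} → Split h h₁₂ h₃ → Split h₁₂ h₁ h₂ →
                 Split h h₁ (h₂ ∪ h₃) × Split (h₂ ∪ h₃) h₂ h₃
  split-assocʳ sp sp' with split-assocˡ (split-comm sp) (split-comm sp')
  ... | sp₁ , sp₂ = split-comm (split-congˡ e sp₁) , split-cong e (split-comm sp₂)
    where e = ∪-comm (split-disjoint sp₂)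

  ↦-⊑ : ∀ {a b h} → h a ≡ just b → a ↦ b ⊑ h
  ↦-⊑ ha c e with ↦-dom e
  ... | refl = trans ha (cong just (just-unique (↦-here _ _) e))

  -- Spatial conjunctions

  -- Right-nested form of ⟦ Σ ⟧ ending in emp, without the special case for singletons.
  infix 4 _,_⊨⋆_
  _,_⊨⋆_ : Stack → Heap → SpConj → Set
  s , h ⊨⋆ [] = EmptyHeap h
  s , h ⊨⋆ (S ∷ Σ) = ∃ λ h₁ → ∃ λ h₂ → Split h h₁ h₂ × s , h₁ ⊨ spat S × s , h₂ ⊨⋆ Σ

  LsegH-cong : ∀ {z a h h'} → h ≐ h' → LsegH z a h → LsegH z a h'
  LsegH-cong e (done ε) = done (EmptyHeap-cong e ε)
  LsegH-cong e (step a≢z sp pts l) = step a≢z (split-cong e sp) pts l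

  LsegH-empty : ∀ {z a h} → a ≡ z → LsegH z a h → EmptyHeap h
  LsegH-empty _ (done ε) = ε
  LsegH-empty a≡z (step a≢z _ _ _) = ⊥-elim (a≢z a≡z)

  LsegH-refl : ∀ {z a h} → a ≡ z → EmptyHeap h → LsegH z a h
  LsegH-refl refl ε = done ε

  LsegH-uncons : ∀ {z a h} → a ≢ z → LsegH z a h →
                 ∃ λ b → ∃ λ h₁ → ∃ λ h₂ → Split h h₁ h₂ × PointsTo a b h₁ × LsegH z b h₂
  LsegH-uncons a≢z (done _) = ⊥-elim (a≢z refl)
  LsegH-uncons _ (step _ sp pts l) = _ , _ , _ , sp , pts , l

  LsegH-head : ∀ {z a h} → a ≢ z → LsegH z a h → a ∈dom h
  LsegH-head a≢z l with LsegH-uncons a≢z l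
  ... | _ , _ , _ , sp , pts , _ = _ , split-⊑ˡ sp _ (proj₁ pts)

  LsegH-append : ∀ {x y z h h₁ h₂} → LsegH y x h₁ → LsegH z y h₂ → Split h h₁ h₂ → h₁ z ≡ nothing →
                 LsegH z x h
  LsegH-append (done ε) l₂ sp _ = LsegH-cong (≐-sym (split-emptyˡ ε sp)) l₂
  LsegH-append {x} {z = z} (step _ sp₁ pts l₁) l₂ sp z∉h₁ with split-assocʳ sp sp₁
  ... | sp' , sp'' = step x≢z sp' pts (LsegH-append l₁ l₂ sp'' (⊑-nothing (split-⊑ʳ sp₁) z∉h₁))
    where
    x≢z : x ≢ z
    x≢z refl = nothing≢just z∉h₁ (split-⊑ˡ sp₁ _ (proj₁ pts))

  Sat-cong : ∀ {s} S {h h'} → h ≐ h' → s , h ⊨ spat S → s , h' ⊨ spat S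
  Sat-cong emp = EmptyHeap-cong
  Sat-cong (next _ _) = PointsTo-cong
  Sat-cong (lseg _ _) = LsegH-cong

  ⊨⋆-cong : ∀ {s} Σ {h h'} → h ≐ h' → s , h ⊨⋆ Σ → s , h' ⊨⋆ Σ
  ⊨⋆-cong [] = EmptyHeap-cong
  ⊨⋆-cong (_ ∷ _) e (h₁ , h₂ , sp , sat , sats) = h₁ , h₂ , split-cong e sp , sat , sats

  ⟦⟧⇒⊨⋆ : ∀ {s} Σ {h} → s , h ⊨ ⟦ Σ ⟧ → s , h ⊨⋆ Σ
  ⟦⟧⇒⊨⋆ [] ε = ε
  ⟦⟧⇒⊨⋆ (S ∷ []) {h} sat = h , ∅ , split-comm split-∅ , sat , ∅-empty
  ⟦⟧⇒⊨⋆ (S ∷ Σ@(_ ∷ _)) (h₁ , h₂ , sp , sat , sats) = h₁ , h₂ , sp , sat , ⟦⟧⇒⊨⋆ Σ sats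

  ⊨⋆⇒⟦⟧ : ∀ {s} Σ {h} → s , h ⊨⋆ Σ → s , h ⊨ ⟦ Σ ⟧
  ⊨⋆⇒⟦⟧ [] ε = ε
  ⊨⋆⇒⟦⟧ (S ∷ []) (_ , _ , sp , sat , ε) = Sat-cong S (≐-sym (split-emptyˡ ε (split-comm sp))) sat
  ⊨⋆⇒⟦⟧ (S ∷ Σ@(_ ∷ _)) (h₁ , h₂ , sp , sat , sats) = h₁ , h₂ , sp , sat , ⊨⋆⇒⟦⟧ Σ sats

  ⊨⋆-++⁻ : ∀ {s} Γ Δ {h} → s , h ⊨⋆ Γ ++ Δ →
           ∃ λ h₁ → ∃ λ h₂ → Split h h₁ h₂ × s , h₁ ⊨⋆ Γ × s , h₂ ⊨⋆ Δ
  ⊨⋆-++⁻ [] Δ {h} sats = ∅ , h , split-∅ , ∅-empty , sats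
  ⊨⋆-++⁻ (S ∷ Γ) Δ (h₁ , h₂ , sp , sat , sats) with ⊨⋆-++⁻ Γ Δ sats
  ... | h₂₁ , h₂₂ , sp' , satsΓ , satsΔ with split-assocˡ sp sp'
  ...   | sp₁ , sp₂ = h₁ ∪ h₂₁ , h₂₂ , sp₁ , (h₁ , h₂₁ , sp₂ , sat , satsΓ) , satsΔ

  ⊨⋆-++⁺ : ∀ {s} Γ Δ {h h₁ h₂} → Split h h₁ h₂ → s , h₁ ⊨⋆ Γ → s , h₂ ⊨⋆ Δ → s , h ⊨⋆ Γ ++ Δ
  ⊨⋆-++⁺ [] Δ sp ε sats = ⊨⋆-cong Δ (≐-sym (split-emptyˡ ε sp)) sats
  ⊨⋆-++⁺ (S ∷ Γ) Δ sp (h₁₁ , h₁₂ , sp' , sat , satsΓ) satsΔ with split-assocʳ sp sp'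
  ... | sp₁ , sp₂ = h₁₁ , _ , sp₁ , sat , ⊨⋆-++⁺ Γ Δ sp₂ satsΓ satsΔ

  ⊨⋆-resp-↭ : ∀ {s Γ Δ h} → Γ ↭ Δ → s , h ⊨⋆ Γ → s , h ⊨⋆ Δ
  ⊨⋆-resp-↭ ↭-refl sats = sats
  ⊨⋆-resp-↭ (prep _ p) (h₁ , h₂ , sp , sat , sats) = h₁ , h₂ , sp , sat , ⊨⋆-resp-↭ p sats
  ⊨⋆-resp-↭ (swap _ _ p) (h₁ , h₂ , sp , sat₁ , (h₂₁ , h₂₂ , sp' , sat₂ , sats))
    with split-assocʳ (split-comm sp) sp'
  ... | sp₁ , sp₂ = h₂₁ , _ , sp₁ , sat₂ , (h₁ , h₂₂ , split-comm sp₂ , sat₁ , ⊨⋆-resp-↭ p sats)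
  ⊨⋆-resp-↭ (↭-trans p q) sats = ⊨⋆-resp-↭ q (⊨⋆-resp-↭ p sats)

  Pick⇒↭ : ∀ {S Σ R} → Pick S Σ R → Σ ↭ S ∷ R
  Pick⇒↭ here = ↭-refl
  Pick⇒↭ (there {S} {T} p) = ↭-trans (prep T (Pick⇒↭ p)) (swap T S ↭-refl)

  Pick⇒∈ : ∀ {S Σ R} → Pick S Σ R → S ∈ Σ
  Pick⇒∈ here = here refl
  Pick⇒∈ (there p) = there (Pick⇒∈ p)

  Any⇒Pick : ∀ {P : SP → Set} {Σ} → Any P Σ → ∃ λ S → ∃ λ R → Pick S Σ R × P S
  Any⇒Pick (here px) = _ , _ , here , px
  Any⇒Pick (there any) with Any⇒Pick any
  ... | S , R , p , px = S , _ , there p , px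

  ⊨⋆-pick⁻ : ∀ {s S Σ R h} → Pick S Σ R → s , h ⊨⋆ Σ →
             ∃ λ h₁ → ∃ λ h₂ → Split h h₁ h₂ × s , h₁ ⊨ spat S × s , h₂ ⊨⋆ R
  ⊨⋆-pick⁻ p = ⊨⋆-resp-↭ (Pick⇒↭ p)

  ⊨⋆-pick⁺ : ∀ {s S Σ R h h₁ h₂} → Pick S Σ R →
             Split h h₁ h₂ → s , h₁ ⊨ spat S → s , h₂ ⊨⋆ R → s , h ⊨⋆ Σ
  ⊨⋆-pick⁺ p sp sat sats = ⊨⋆-resp-↭ (↭-sym (Pick⇒↭ p)) (_ , _ , sp , sat , sats)

  -- Allocation and well-formedness

  Allocates : Stack → SP → ℤ → Set
  Allocates s emp v = ⊥
  Allocates s (next a _) v = eval a s ≡ v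
  Allocates s (lseg a b) v = eval a s ≢ eval b s × eval a s ≡ v

  Allocated : Stack → SpConj → ℤ → Set
  Allocated s Σ v = Any (λ S → Allocates s S v) Σ

  Collides : Stack → SP → SP → Set
  Collides s S T = ∃ λ v → Allocates s S v × Allocates s T v

  Separated : Stack → SpConj → Set
  Separated s = AllPairs (λ S T → ¬ Collides s S T)

  Allocates⇒¬Empty : ∀ {s} S {v} → Allocates s S v → ¬ (s ⊨ₚ Empty S)
  Allocates⇒¬Empty (lseg _ _) (a≢b , _) = a≢b

  ¬Empty⇒Allocates : ∀ {s} S → ¬ (s ⊨ₚ Empty S) → ∃ λ v → Allocates s S v
  ¬Empty⇒Allocates emp ¬empty = ⊥-elim (¬empty tt)
  ¬Empty⇒Allocates (next _ _) _ = _ , refl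
  ¬Empty⇒Allocates (lseg _ _) ¬empty = _ , ¬empty , refl

  Alloc⇒Allocated : ∀ {s} Σ x → s ⊨ₚ Alloc Σ x → Allocated s Σ (eval x s)
  Alloc⇒Allocated (next _ _ ∷ _) _ (inj₁ (_ , x≡a)) = here (sym x≡a)
  Alloc⇒Allocated (lseg _ _ ∷ _) _ (inj₁ (a≢b , x≡a)) = here (a≢b , sym x≡a)
  Alloc⇒Allocated (_ ∷ Σ) x (inj₂ alloc) = there (Alloc⇒Allocated Σ x alloc)

  Allocated⇒Alloc : ∀ {s} Σ x → Allocated s Σ (eval x s) → s ⊨ₚ Alloc Σ x
  Allocated⇒Alloc (next _ _ ∷ _) _ (here a≡x) = inj₁ ((λ ()) , sym a≡x)
  Allocated⇒Alloc (lseg _ _ ∷ _) _ (here (a≢b , a≡x)) = inj₁ (a≢b , sym a≡x)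
  Allocated⇒Alloc (_ ∷ Σ) x (there alloc) = inj₂ (Allocated⇒Alloc Σ x alloc)

  Collides⇒Collide : ∀ {s} S T → Collides s S T → s ⊨ₚ Collide S T
  Collides⇒Collide (next _ _) (next _ _) (_ , refl , a'≡) = (λ ()) , (λ ()) , sym a'≡
  Collides⇒Collide (next _ _) (lseg _ _) (_ , refl , ne' , a'≡) = (λ ()) , ne' , sym a'≡
  Collides⇒Collide (lseg _ _) (next _ _) (_ , (ne , refl) , a'≡) = ne , (λ ()) , sym a'≡
  Collides⇒Collide (lseg _ _) (lseg _ _) (_ , (ne , refl) , ne' , a'≡) = ne , ne' , sym a'≡

  WellFormed⇒Separated : ∀ {s} Σ → s ⊨ₚ WellFormed Σ → Separated s Σ
  WellFormed⇒Separated [] _ = []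
  WellFormed⇒Separated (S ∷ Σ) (noCollide , wf) = apart Σ noCollide ∷ WellFormed⇒Separated Σ wf
    where
    apart : ∀ Γ → _ ⊨ₚ NoCollideWith S Γ → All (λ T → ¬ Collides _ S T) Γ
    apart [] _ = []
    apart (T ∷ Γ) (¬collide , rest) = (¬collide ∘ Collides⇒Collide S T) ∷ apart Γ rest

  AllPairs-resp-↭ : ∀ {A : Set} {R : A → A → Set} → (∀ {x y} → R x y → R y x) →
                    ∀ {xs ys} → xs ↭ ys → AllPairs R xs → AllPairs R ys
  AllPairs-resp-↭ R-sym ↭-refl rs = rs
  AllPairs-resp-↭ R-sym (prep _ p) (r ∷ rs) = All-resp-↭ p r ∷ AllPairs-resp-↭ R-sym p rs
  AllPairs-resp-↭ R-sym (swap _ _ p) ((rxy ∷ rx) ∷ ry ∷ rs) =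
    (R-sym rxy ∷ All-resp-↭ p ry) ∷ All-resp-↭ p rx ∷ AllPairs-resp-↭ R-sym p rs
  AllPairs-resp-↭ R-sym (↭-trans p q) rs = AllPairs-resp-↭ R-sym q (AllPairs-resp-↭ R-sym p rs)

  ¬Collides-sym : ∀ {s S T} → ¬ Collides s S T → ¬ Collides s T S
  ¬Collides-sym ¬c (v , t , s) = ¬c (v , s , t)

  Separated-pick : ∀ {s S Σ R} → Pick S Σ R → Separated s Σ →
                   All (λ T → ¬ Collides s S T) R × Separated s R
  Separated-pick p sep with AllPairs-resp-↭ ¬Collides-sym (Pick⇒↭ p) sep
  ... | apart ∷ sep' = apart , sep'

  apart⇒¬Allocated : ∀ {s S Σ v} → All (λ T → ¬ Collides s S T) Σ → Allocates s S v → ¬ Allocated s Σ v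
  apart⇒¬Allocated apart sv tv with All.lookupAny apart tv
  ... | ¬c , tv' = ¬c (_ , sv , tv')

  Allocated-pick⁻ : ∀ {s S Σ R v} → Pick S Σ R → Allocated s Σ v → Allocates s S v ⊎ Allocated s R v
  Allocated-pick⁻ here (here sv) = inj₁ sv
  Allocated-pick⁻ here (there rv) = inj₂ rv
  Allocated-pick⁻ (there p) (here tv) = inj₂ (here tv)
  Allocated-pick⁻ (there p) (there rv) = Sum.map₂ there (Allocated-pick⁻ p rv)

  Allocated-pickˡ : ∀ {s S Σ R v} → Pick S Σ R → Allocates s S v → Allocated s Σ v
  Allocated-pickˡ here sv = here sv
  Allocated-pickˡ (there p) sv = there (Allocated-pickˡ p sv)

  Allocated-pickʳ : ∀ {s S Σ R v} → Pick S Σ R → Allocated s R v → Allocated s Σ v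
  Allocated-pickʳ here rv = there rv
  Allocated-pickʳ (there p) (here tv) = here tv
  Allocated-pickʳ (there p) (there rv) = there (Allocated-pickʳ p rv)

  Sat-empty : ∀ {s} S {h} → s ⊨ₚ Empty S → s , h ⊨ spat S → EmptyHeap h
  Sat-empty emp _ ε = ε
  Sat-empty (lseg _ _) a≡b l = LsegH-empty a≡b l

  empty-Sat : ∀ {s} S {h} → s ⊨ₚ Empty S → EmptyHeap h → s , h ⊨ spat S
  empty-Sat emp _ ε = ε
  empty-Sat (lseg _ _) a≡b ε = LsegH-refl a≡b ε

  Sat-allocates : ∀ {s} S {h v} → s , h ⊨ spat S → Allocates s S v → v ∈dom h
  Sat-allocates (next _ _) (ha , _) refl = _ , ha
  Sat-allocates (lseg _ _) l (a≢b , refl) = LsegH-head a≢b l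

  ⊨⋆-allocated : ∀ {s Σ h v} → s , h ⊨⋆ Σ → Allocated s Σ v → v ∈dom h
  ⊨⋆-allocated {Σ = S ∷ _} (_ , _ , sp , sat , _) (here sv) =
    Product.map₂ (split-⊑ˡ sp _) (Sat-allocates S sat sv)
  ⊨⋆-allocated (_ , _ , sp , _ , sats) (there rv) =
    Product.map₂ (split-⊑ʳ sp _) (⊨⋆-allocated sats rv)

  -- Soundness

  -- Invariant of Match: besides the addresses of Σ, h owns no address allocated by Σ̂. It is what
  -- makes the Check for two list segments sound.
  Confined : Stack → SpConj → SpConj → Heap → Set
  Confined s Σ̂ Σ h = ∀ v → Allocated s Σ̂ v → Allocated s Σ v ⊎ h v ≡ nothing

  Confined-pick : ∀ {s Σ̂ S Σ R h h₁ h₂} → Pick S Σ R → Split h h₁ h₂ →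
                  s , h₁ ⊨ spat S → s , h₂ ⊨⋆ R → Confined s Σ̂ Σ h →
                  Confined s Σ̂ R h₂ × (∀ v → Allocated s Σ̂ v → Allocates s S v ⊎ h₁ v ≡ nothing)
  Confined-pick {s} {Σ̂} {S} {R = R} {h₁ = h₁} {h₂} p sp sat sats conf = confined-rest , confined-picked
    where
    confined-rest : Confined s Σ̂ R h₂
    confined-rest v v∈Σ̂ with conf v v∈Σ̂
    ... | inj₂ hv = inj₂ (⊑-nothing (split-⊑ʳ sp) hv)
    ... | inj₁ v∈Σ with Allocated-pick⁻ p v∈Σ
    ...   | inj₁ sv = inj₂ (split-apartˡ sp (proj₂ (Sat-allocates S sat sv)))
    ...   | inj₂ rv = inj₁ rv
    confined-picked : ∀ v → Allocated s Σ̂ v → Allocates s S v ⊎ h₁ v ≡ nothing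
    confined-picked v v∈Σ̂ with conf v v∈Σ̂
    ... | inj₂ hv = inj₂ (⊑-nothing (split-⊑ˡ sp) hv)
    ... | inj₁ v∈Σ with Allocated-pick⁻ p v∈Σ
    ...   | inj₁ sv = inj₁ sv
    ...   | inj₂ rv = inj₂ (split-apartˡ (split-comm sp) (proj₂ (⊨⋆-allocated sats rv)))

  ⊨⋆-pick-empty⁻ : ∀ {s S Σ R h} → Pick S Σ R → s ⊨ₚ Empty S → s , h ⊨⋆ Σ → s , h ⊨⋆ R
  ⊨⋆-pick-empty⁻ {S = S} {R = R} p empty sats with ⊨⋆-pick⁻ p sats
  ... | _ , _ , sp , sat , satsR = ⊨⋆-cong R (≐-sym (split-emptyˡ (Sat-empty S empty sat) sp)) satsR

  ⊨⋆-pick-empty⁺ : ∀ {s S Σ R h} → Pick S Σ R → s ⊨ₚ Empty S → s , h ⊨⋆ R → s , h ⊨⋆ Σ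
  ⊨⋆-pick-empty⁺ {S = S} p empty = ⊨⋆-pick⁺ p split-∅ (empty-Sat S empty ∅-empty)

  Confined-pick-empty : ∀ {s Σ̂ S Σ R h} → Pick S Σ R → s ⊨ₚ Empty S → Confined s Σ̂ Σ h → Confined s Σ̂ R h
  Confined-pick-empty {S = S} p empty conf v v∈Σ̂ =
    Sum.map₁ [ (λ sv → ⊥-elim (Allocates⇒¬Empty S sv empty)) , id ]′ (Sum.map₁ (Allocated-pick⁻ p) (conf v v∈Σ̂))

  Update-sound : ∀ {s Σ̂} S S' {h h₁ h₂} → s ⊨ₚ Guard Σ̂ S S' → Split h h₁ h₂ →
                 s , h₁ ⊨ spat S → s , h₂ ⊨ spat (Update S S') →
                 (∀ v → Allocated s Σ̂ v → Allocates s S v ⊎ h₁ v ≡ nothing) → s , h ⊨ spat S'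
  Update-sound (next _ _) (next _ _) ((_ , _ , x≡x') , y≡z) sp pts ε _ =
    subst₂ (λ a b → PointsTo a b _) x≡x' y≡z (PointsTo-cong (≐-sym (split-emptyˡ ε (split-comm sp))) pts)
  Update-sound {s} (next _ y) (lseg _ _) {h₁ = h₁} ((_ , x'≢z , x≡x') , _) sp pts l _ =
    step x'≢z sp (subst (λ a → PointsTo a (eval y s) h₁) x≡x' pts) l
  Update-sound {s} (lseg x y) (lseg x' z) {h} ((_ , x'≢z , x≡x') , check) sp l₁ l₂ confined
    with eval y s ℤ.≟ eval z s
  ... | yes y≡z =
    subst₂ (λ a b → LsegH b a _) x≡x' y≡z (LsegH-cong (≐-sym (split-emptyˡ (LsegH-empty y≡z l₂) (split-comm sp))) l₁)
  ... | no y≢z with confined (eval z s) (Alloc⇒Allocated _ z (check y≢z))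
  ...   | inj₁ (_ , x≡z) = ⊥-elim (x'≢z (trans (sym x≡x') x≡z))
  ...   | inj₂ z∉h₁ = subst (λ a → LsegH (eval z s) a h) x≡x' (LsegH-append l₁ l₂ sp z∉h₁)

  Final-sound : ∀ {s h} Γ Δ → s ⊨ₚ Final Γ Δ → s , h ⊨⋆ Γ → s , h ⊨⋆ Δ
  Final-sound [] [] _ sats = sats

  sound : ∀ {s Σ̂ Σ Σ' U} → Match s Σ̂ Σ Σ' U →
          ∀ {s' h} → s' ⊨ₚ U → s' , h ⊨⋆ Σ → Confined s' Σ̂ Σ h → s' , h ⊨⋆ Σ'
  sound (m1 p _ M) (empty , u) sats conf =
    sound M u (⊨⋆-pick-empty⁻ p empty sats) (Confined-pick-empty p empty conf)
  sound (m2 _ p' _ M) (empty , u) sats conf = ⊨⋆-pick-empty⁺ p' empty (sound M u sats conf)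
  sound (m3 {S = S} {S'} {R' = R'} _ _ p p' _ M) (guard , u) sats conf with ⊨⋆-pick⁻ p sats
  ... | _ , _ , sp , sat , satsR with Confined-pick p sp sat satsR conf
  ... | confR , confS with ⊨⋆-++⁻ R' (Update S S' ∷ []) (sound M u satsR confR)
  ... | _ , _ , sq , satsR' , satU with split-assocˡ sp (split-comm sq)
  ... | sp₁ , sp₂ =
    ⊨⋆-pick⁺ p' sp₁ (Update-sound S S' guard sp₂ sat (⊨⋆⇒⟦⟧ (Update S S' ∷ []) satU) confS) satsR'
  sound (m4 {Σ₁ = Σ} {Σ'} _ _ _) final sats _ = Final-sound Σ Σ' final sats

  -- Canonical heaps

  Allocates? : ∀ s S v → Dec (Allocates s S v)
  Allocates? s emp v = no λ ()
  Allocates? s (next a _) v = eval a s ℤ.≟ v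
  Allocates? s (lseg a b) v = ¬? (eval a s ℤ.≟ eval b s) ×-dec (eval a s ℤ.≟ v)

  Allocated? : ∀ s Σ v → Dec (Allocated s Σ v)
  Allocated? s Σ v = Any.any? (λ S → Allocates? s S v) Σ

  -- Address and target of the cell of a non-empty predicate; the values at emp are junk.
  addr : Stack → SP → ℤ
  addr s emp = + 0
  addr s (next a _) = eval a s
  addr s (lseg a _) = eval a s

  target : Stack → SP → ℤ
  target s emp = + 0
  target s (next _ b) = eval b s
  target s (lseg _ b) = eval b s

  canon : Stack → SP → Heap
  canon s emp = ∅
  canon s (next a b) = eval a s ↦ eval b s
  canon s (lseg a b) with eval a s ℤ.≟ eval b s
  ... | yes _ = ∅
  ... | no _ = eval a s ↦ eval b s

  canon⋆ : Stack → SpConj → Heap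
  canon⋆ s [] = ∅
  canon⋆ s (S ∷ Σ) = canon s S ∪ canon⋆ s Σ

  canon-Sat : ∀ {s} S → s , canon s S ⊨ spat S
  canon-Sat emp = ∅-empty
  canon-Sat (next _ _) = ↦-PointsTo _ _
  canon-Sat {s} (lseg a b) with eval a s ℤ.≟ eval b s
  ... | yes a≡b = LsegH-refl a≡b ∅-empty
  ... | no a≢b = step a≢b (split-comm split-∅) (↦-PointsTo _ _) (done ∅-empty)

  canon-dom : ∀ {s} S {v w} → canon s S v ≡ just w → Allocates s S v
  canon-dom (next _ _) e = ↦-dom e
  canon-dom {s} (lseg a b) e with eval a s ℤ.≟ eval b s
  ... | no a≢b = a≢b , ↦-dom e

  canon-nothing : ∀ {s} S {v} → ¬ Allocates s S v → canon s S v ≡ nothing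
  canon-nothing {s} S {v} ¬sv with canon s S v in e
  ... | nothing = refl
  ... | just _ = ⊥-elim (¬sv (canon-dom S e))

  canon-≐↦ : ∀ {s} S {a} → Allocates s S a → canon s S ≐ a ↦ target s S
  canon-≐↦ (next _ _) refl _ = refl
  canon-≐↦ {s} (lseg a b) (a≢b , refl) v with eval a s ℤ.≟ eval b s
  ... | yes a≡b = ⊥-elim (a≢b a≡b)
  ... | no _ = refl

  canon⋆-dom : ∀ {s} Σ {v w} → canon⋆ s Σ v ≡ just w → Allocated s Σ v
  canon⋆-dom {s} (S ∷ Σ) {v} e with canon s S v in eS
  ... | just _ = here (canon-dom S eS)
  ... | nothing = there (canon⋆-dom Σ e)

  canon⋆-nothing : ∀ {s} Σ {v} → ¬ Allocated s Σ v → canon⋆ s Σ v ≡ nothing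
  canon⋆-nothing {s} Σ {v} ¬v∈Σ with canon⋆ s Σ v in e
  ... | nothing = refl
  ... | just _ = ⊥-elim (¬v∈Σ (canon⋆-dom Σ e))

  canon⋆-Sat : ∀ {s} Σ → Separated s Σ → s , canon⋆ s Σ ⊨⋆ Σ
  canon⋆-Sat [] _ = ∅-empty
  canon⋆-Sat {s} (S ∷ Σ) (apart ∷ sep) =
    canon s S , canon⋆ s Σ , split-∪ disjoint , canon-Sat S , canon⋆-Sat Σ sep
    where
    disjoint : Disjoint (canon s S) (canon⋆ s Σ)
    disjoint v with canon s S v in e
    ... | nothing = inj₁ refl
    ... | just _ = inj₂ (canon⋆-nothing Σ (apart⇒¬Allocated apart (canon-dom S e)))

  canon⋆-pick : ∀ {s S Σ R a} → Pick S Σ R → Separated s Σ → Allocates s S a →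
                canon⋆ s Σ ≐ (a ↦ target s S) ∪ canon⋆ s R
  canon⋆-pick {S = S} here _ sa = ∪-cong (canon-≐↦ S sa) (λ _ → refl)
  canon⋆-pick {s} {S} {a = a} (there {T = T} {R = R} p) (apart ∷ sep) sa v
    rewrite canon⋆-pick p sep sa v with v ℤ.≟ a
  ... | yes refl rewrite canon-nothing T (λ tv → All.lookup apart (Pick⇒∈ p) (_ , tv , sa)) | ↦-here a (target s S) = refl
  ... | no v≢a rewrite ↦-else {b = target s S} v≢a = refl

  Confined-canon⋆ : ∀ {s Σ̂} Σ → Confined s Σ̂ Σ (canon⋆ s Σ)
  Confined-canon⋆ {s} Σ v _ with canon⋆ s Σ v in e
  ... | just _ = inj₁ (canon⋆-dom Σ e)
  ... | nothing = inj₂ refl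

  -- List segments inside a heap

  Path : Heap → ℤ → ℤ → Set
  Path H w a = ∃ λ p → p ⊑ H × LsegH w a p

  Path-cong : ∀ {H H' w a} → H ≐ H' → Path H w a → Path H' w a
  Path-cong e (p , p⊑H , l) = p , (λ c pc → trans (sym (e c)) (p⊑H c pc)) , l

  Path-refl : ∀ {H w a} → a ≡ w → Path H w a
  Path-refl a≡w = ∅ , ∅-⊑ , LsegH-refl a≡w ∅-empty

  Path-step : ∀ {H w a} → a ≢ w → Path H w a → ∃ λ b → H a ≡ just b × Path H w b
  Path-step a≢w (p , p⊑H , l) with LsegH-uncons a≢w l
  ... | b , _ , r , sp , pts , l' = b , p⊑H _ (split-⊑ˡ sp _ (proj₁ pts)) , r , ⊑-trans (split-⊑ʳ sp) p⊑H , l'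

  Path-head : ∀ {H w a} → a ≢ w → Path H w a → a ∈dom H
  Path-head a≢w path = Product.map₂ proj₁ (Path-step a≢w path)

  Path-cons : ∀ {H w a b} → H a ≡ nothing → a ≢ w → Path H w b → Path (a ↦ b ∪ H) w a
  Path-cons {H} {a = a} {b} Ha a≢w (p , p⊑H , l) =
    a ↦ b ∪ p , ⊑∪ , step a≢w (split-∪ (↦-disjoint (⊑-nothing p⊑H Ha))) (↦-PointsTo a b) l
    where
    ⊑∪ : a ↦ b ∪ p ⊑ a ↦ b ∪ H
    ⊑∪ c e with (a ↦ b) c
    ... | just _ = e
    ... | nothing = p⊑H c e

  Path-uncons : ∀ {H w a b} → a ≢ w → Path (a ↦ b ∪ H) w a → Path H w b
  Path-uncons {H} {a = a} {b} a≢w (p , p⊑ , l) with LsegH-uncons a≢w l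
  ... | b' , _ , r , sp , pts , l' = r , r⊑H , subst (λ c → LsegH _ c r) b'≡b l'
    where
    pa : p a ≡ just b'
    pa = split-⊑ˡ sp _ (proj₁ pts)
    b'≡b : b' ≡ b
    b'≡b = just-unique (p⊑ _ pa) (∪-just {a ↦ b} {H} (↦-here a b))
    r⊑H : r ⊑ H
    r⊑H c rc = trans (sym (∪-nothing {a ↦ b} {H} (↦-else c≢a))) (p⊑ c (split-⊑ʳ sp c rc))
      where
      c≢a : c ≢ a
      c≢a refl = nothing≢just (split-apartˡ sp (proj₁ pts)) rc

  Pick-length : ∀ {S Σ R} → Pick S Σ R → length Σ ≡ suc (length R)
  Pick-length here = refl
  Pick-length (there p) = cong suc (Pick-length p)

  -- Recursion on the length of Σ: following the cell at a removes its conjunct from Σ.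
  path? : ∀ {s} n Σ → length Σ ≡ n → Separated s Σ → ∀ w a → Dec (Path (canon⋆ s Σ) w a)
  path? {s} n Σ len sep w a with a ℤ.≟ w | Allocated? s Σ a
  ... | yes a≡w | _ = yes (Path-refl a≡w)
  ... | no a≢w | no a∉Σ = no λ path → nothing≢just (canon⋆-nothing Σ a∉Σ) (proj₂ (Path-head a≢w path))
  ... | no a≢w | yes a∈Σ with Any⇒Pick a∈Σ | n
  ...   | _ , _ , p , _ | zero = ⊥-elim (1+n≢0 (trans (sym (Pick-length p)) len))
  ...   | S , R , p , sa | suc m =
    Dec.map′ (Path-cong (≐-sym Σ≐) ∘ Path-cons Ra a≢w) (Path-uncons a≢w ∘ Path-cong Σ≐)
      (path? m R (suc-injective (trans (sym (Pick-length p)) len)) sepR w (target s S))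
    where
    Σ≐ : canon⋆ s Σ ≐ a ↦ target s S ∪ canon⋆ s R
    Σ≐ = canon⋆-pick p sep sa
    sepR : Separated s R
    sepR = proj₂ (Separated-pick p sep)
    Ra : canon⋆ s R a ≡ nothing
    Ra = canon⋆-nothing R (apart⇒¬Allocated (proj₁ (Separated-pick p sep)) sa)

  Fits : Stack → Heap → SP → Set
  Fits s H P = ∃ λ p → p ⊑ H × s , p ⊨ spat P

  fits? : ∀ {s} Σ → Separated s Σ → ∀ P → Dec (Fits s (canon⋆ s Σ) P)
  fits? Σ sep emp = yes (∅ , ∅-⊑ , ∅-empty)
  fits? {s} Σ sep (next a b) =
    Dec.map′ (λ e → _ , ↦-⊑ e , ↦-PointsTo _ _) (λ (_ , p⊑H , pts) → p⊑H _ (proj₁ pts))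
      (≡-dec ℤ._≟_ (canon⋆ s Σ (eval a s)) (just (eval b s)))
  fits? Σ sep (lseg a b) = path? _ Σ refl sep _ _

  ⊨⋆-fits : ∀ {s} Σ {q H} → s , q ⊨⋆ Σ → q ⊑ H → All (Fits s H) Σ
  ⊨⋆-fits [] _ _ = []
  ⊨⋆-fits (_ ∷ Σ) (h₁ , _ , sp , sat , sats) q⊑H =
    (h₁ , ⊑-trans (split-⊑ˡ sp) q⊑H , sat) ∷ ⊨⋆-fits Σ sats (⊑-trans (split-⊑ʳ sp) q⊑H)

  ⊨⋆-find : ∀ {s} Σ {q z} → s , q ⊨⋆ Σ → z ∈dom q →
            Any (λ P → ∃ λ p → p ⊑ q × s , p ⊨ spat P × z ∈dom p) Σ
  ⊨⋆-find [] ε (_ , qz) = ⊥-elim (nothing≢just (ε _) qz)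
  ⊨⋆-find (_ ∷ Σ) {z = z} (h₁ , _ , sp , sat , sats) (u , qz) with h₁ z in e
  ... | just u' = here (h₁ , split-⊑ˡ sp , sat , u' , e)
  ... | nothing =
    there (Any.map (Product.map₂ (Product.map₁ (λ p⊑ → ⊑-trans p⊑ (split-⊑ʳ sp))))
                   (⊨⋆-find Σ sats (u , trans (sym (split-outˡ sp e)) qz)))

  Agree : Heap → Heap → Heap → ℤ → Set
  Agree p H H' z = ∀ c → c ∈dom p → c ≢ z → H c ≡ H' c

  LsegH-transfer : ∀ {w a p H H' z} → LsegH w a p → p ⊑ H' → Agree p H H' z → z ∈dom p →
                   Path H w a → z ∈dom H
  LsegH-transfer (done ε) _ _ (_ , pz) _ = ⊥-elim (nothing≢just (ε _) pz)
  LsegH-transfer {p = p} {H} {H'} {z} (step {a = a} {b} {h₂ = r} a≢w sp pts l) p⊑H' agree (u , pz) path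
    with a ℤ.≟ z | Path-step a≢w path
  ... | yes refl | _ = Path-head a≢w path
  ... | no a≢z | b' , Ha , path' =
    LsegH-transfer l (⊑-trans (split-⊑ʳ sp) p⊑H') agree'
      (u , trans (sym (split-outˡ sp (proj₂ pts z (a≢z ∘ sym)))) pz)
      (subst (Path H _) (just-unique Ha Ha') path')
    where
    pa : p a ≡ just b
    pa = split-⊑ˡ sp _ (proj₁ pts)
    Ha' : H a ≡ just b
    Ha' = trans (agree a (_ , pa) a≢z) (p⊑H' _ pa)
    agree' : Agree r H H' z
    agree' c (v , rc) = agree c (v , split-⊑ʳ sp c rc)

  Fits-transfer : ∀ {s} P {p H H' z} → s , p ⊨ spat P → p ⊑ H' → Agree p H H' z → z ∈dom p →
                  Fits s H P → z ∈dom H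
  Fits-transfer emp ε _ _ (_ , pz) _ = ⊥-elim (nothing≢just (ε _) pz)
  Fits-transfer {s} (next a _) {z = z} (_ , else) _ _ (_ , pz) (_ , p₀⊑H , pts₀) with z ℤ.≟ eval a s
  ... | yes refl = _ , p₀⊑H _ (proj₁ pts₀)
  ... | no z≢a = ⊥-elim (nothing≢just (else z z≢a) pz)
  Fits-transfer (lseg _ _) l p⊑H' agree z∈p (p₀ , p₀⊑H , l₀) =
    LsegH-transfer l p⊑H' agree z∈p (p₀ , p₀⊑H , l₀)

  -- Completeness

  fresh : List ℤ → ℤ
  fresh vs = + suc (max 0 (List.map ℤ.∣_∣ vs))

  fresh-∉ : ∀ {v} vs → v ∈ vs → v ≢ fresh vs
  fresh-∉ vs v∈vs refl = 1+n≰n (All.lookup (xs≤max 0 (List.map ℤ.∣_∣ vs)) (∈-map⁺ ℤ.∣_∣ v∈vs))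

  Allocated⇒∈addrs : ∀ {s} Σ {v} → Allocated s Σ v → v ∈ List.map (addr s) Σ
  Allocated⇒∈addrs (next _ _ ∷ _) (here refl) = here refl
  Allocated⇒∈addrs (lseg _ _ ∷ _) (here (_ , refl)) = here refl
  Allocated⇒∈addrs (_ ∷ Σ) (there v∈Σ) = there (Allocated⇒∈addrs Σ v∈Σ)

  detour : ℤ → ℤ → ℤ → Heap
  detour x m y = x ↦ m ∪ m ↦ y

  detour-x : ∀ x m y → detour x m y x ≡ just m
  detour-x x m y = ∪-just {x ↦ m} {m ↦ y} (↦-here x m)

  detour-m : ∀ {x m} y → x ≢ m → detour x m y m ≡ just y
  detour-m {x} {m} y x≢m = trans (∪-nothing {x ↦ m} {m ↦ y} (↦-else (x≢m ∘ sym))) (↦-here m y)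

  detour-dom : ∀ {x m y v w} → detour x m y v ≡ just w → x ≡ v ⊎ m ≡ v
  detour-dom {x} {m} {y} {v} e with (x ↦ m) v in ex
  ... | just _ = inj₁ (↦-dom ex)
  ... | nothing = inj₂ (↦-dom e)

  detour-else : ∀ {x m y v} → v ≢ x → v ≢ m → detour x m y v ≡ nothing
  detour-else {x} {m} {y} v≢x v≢m = trans (∪-nothing {x ↦ m} {m ↦ y} (↦-else v≢x)) (↦-else v≢m)

  detour-LsegH : ∀ {x m y} → x ≢ y → m ≢ y → x ≢ m → LsegH y x (detour x m y)
  detour-LsegH x≢y m≢y x≢m =
    step x≢y (split-∪ (↦-disjoint (↦-else x≢m))) (↦-PointsTo _ _)
      (step m≢y (split-comm split-∅) (↦-PointsTo _ _) (done ∅-empty))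

  FramedModel : Stack → SpConj → SpConj → Heap → Set
  FramedModel s Σ̂ Σ h = s , h ⊨⋆ Σ × Confined s Σ̂ Σ h

  Countermodel : Stack → SpConj → SpConj → SpConj → Set
  Countermodel s Σ̂ Σ Σ' = ∃ λ h → FramedModel s Σ̂ Σ h × ¬ (s , h ⊨⋆ Σ')

  canonical-countermodel : ∀ {s Σ̂ Σ Σ'} → Separated s Σ → ¬ (s , canon⋆ s Σ ⊨⋆ Σ') →
                           Countermodel s Σ̂ Σ Σ'
  canonical-countermodel {s} {Σ = Σ} sep ¬sat = canon⋆ s Σ , (canon⋆-Sat Σ sep , Confined-canon⋆ Σ) , ¬sat

  detour-model : ∀ {s Σ̂ Σ R x y m} → Pick (lseg x y) Σ R → Separated s Σ →
                 Allocated s Σ ⊆′ Allocated s Σ̂ → eval x s ≢ eval y s → m ≢ eval y s → ¬ Allocated s Σ̂ m →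
                 FramedModel s Σ̂ Σ (detour (eval x s) m (eval y s) ∪ canon⋆ s R)
  detour-model {s} {Σ̂} {Σ} {R} {x} {y} {m} p sep Σ⊆Σ̂ x≢y m≢y m∉Σ̂ =
    ⊨⋆-pick⁺ p (split-∪ disjoint) (detour-LsegH x≢y m≢y x≢m) (canon⋆-Sat R sepR) , confined
    where
    X = eval x s
    x∈Σ : Allocated s Σ X
    x∈Σ = Allocated-pickˡ p (x≢y , refl)
    x≢m : X ≢ m
    x≢m refl = m∉Σ̂ (Σ⊆Σ̂ _ x∈Σ)
    sepR : Separated s R
    sepR = proj₂ (Separated-pick p sep)
    R∌ : ∀ {v} → X ≡ v ⊎ m ≡ v → canon⋆ s R v ≡ nothing
    R∌ (inj₁ refl) = canon⋆-nothing R (apart⇒¬Allocated (proj₁ (Separated-pick p sep)) (x≢y , refl))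
    R∌ (inj₂ refl) = canon⋆-nothing R (m∉Σ̂ ∘ Σ⊆Σ̂ _ ∘ Allocated-pickʳ p)
    disjoint : Disjoint (detour X m (eval y s)) (canon⋆ s R)
    disjoint v with detour X m (eval y s) v in e
    ... | nothing = inj₁ refl
    ... | just _ = inj₂ (R∌ (detour-dom {X} {m} {eval y s} e))
    confined : Confined s Σ̂ Σ (detour X m (eval y s) ∪ canon⋆ s R)
    confined v v∈Σ̂ with detour X m (eval y s) v in e | canon⋆ s R v in eR
    ... | just _ | _ = inj₁ ([ (λ { refl → x∈Σ }) , (λ { refl → ⊥-elim (m∉Σ̂ v∈Σ̂) }) ]′ (detour-dom {X} {m} {eval y s} e))
    ... | nothing | just _ = inj₁ (Allocated-pickʳ p (canon⋆-dom R eR))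
    ... | nothing | nothing = inj₂ refl

  LsegH-uncons-at : ∀ {w a b p H} → a ≢ w → LsegH w a p → p ⊑ H → H a ≡ just b →
                    ∃ λ r → Split p (a ↦ b) r × LsegH w b r
  LsegH-uncons-at a≢w l p⊑H Ha with LsegH-uncons a≢w l
  ... | _ , _ , r , sp , pts , l' with just-unique (p⊑H _ (split-⊑ˡ sp _ (proj₁ pts))) Ha
  ...   | refl = r , split-congˡ (PointsTo⇒≐↦ pts) sp , l'

  Update-complete : ∀ {s Σ̂} S S' {a p H} → s ⊨ₚ Guard Σ̂ S S' → Allocates s S a →
                    s , p ⊨ spat S' → p ⊑ H → H a ≡ just (target s S) →
                    ∃ λ r → Split p (a ↦ target s S) r × s , r ⊨ spat (Update S S')
  Update-complete {s} (next _ _) (next x' z) {p = p} ((_ , _ , x≡x') , y≡z) refl pts _ _ =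
    ∅ , split-congˡ (subst₂ (λ a b → p ≐ a ↦ b) (sym x≡x') (sym y≡z) (PointsTo⇒≐↦ pts)) (split-comm split-∅) ,
    ∅-empty
  Update-complete {s} (next _ _) (lseg _ z) {p = p} ((_ , x'≢z , x≡x') , _) refl l p⊑H Ha =
    LsegH-uncons-at (x'≢z ∘ trans (sym x≡x')) (subst (λ a → LsegH (eval z s) a p) (sym x≡x') l) p⊑H Ha
  Update-complete {s} (lseg _ _) (lseg _ z) {p = p} ((_ , x'≢z , x≡x') , _) (_ , refl) l p⊑H Ha =
    LsegH-uncons-at (x'≢z ∘ trans (sym x≡x')) (subst (λ a → LsegH (eval z s) a p) (sym x≡x') l) p⊑H Ha

  detour-remainder : ∀ {s x' z R' X Y C} → eval x' s ≡ X → X ≢ eval z s →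
                     s , detour X (eval z s) Y ∪ C ⊨⋆ lseg x' z ∷ R' →
                     ∃ λ q → q ⊑ detour X (eval z s) Y ∪ C × q X ≡ nothing × eval z s ∈dom q × s , q ⊨⋆ R'
  detour-remainder {s} {z = z} {X = X} {Y} {C} refl X≢Z (p , q , sp , l , sats) with LsegH-uncons X≢Z l
  ... | b , _ , _ , sp' , pts , l' = q , split-⊑ʳ sp , split-apartˡ sp pX , qZ , sats
    where
    Z = eval z s
    pX : p X ≡ just b
    pX = split-⊑ˡ sp' _ (proj₁ pts)
    b≡Z : b ≡ Z
    b≡Z = just-unique (split-⊑ˡ sp _ pX) (∪-just {detour X Z Y} {C} (detour-x X Z Y))
    pZ : p Z ≡ nothing
    pZ = trans (split-outˡ sp' (proj₂ pts Z (X≢Z ∘ sym))) (LsegH-empty b≡Z l' Z)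
    qZ : Z ∈dom q
    qZ = Y , trans (sym (split-outˡ sp pZ)) (∪-just {detour X Z Y} {C} (detour-m Y X≢Z))

  -- The cell at z belongs to a conjunct of R', whose model in x ↦ y ∗ C would follow the same
  -- cells up to z, where that heap is undefined.
  detour-refutes : ∀ {s x' z R' X Y C H₀} → eval x' s ≡ X → X ≢ eval z s → C (eval z s) ≡ nothing →
                   H₀ ≐ X ↦ Y ∪ C → All (Fits s H₀) R' → ¬ (s , detour X (eval z s) Y ∪ C ⊨⋆ lseg x' z ∷ R')
  detour-refutes {s} {z = z} {R'} {X} {Y} {C} {H₀} x'≡X X≢Z CZ H₀≐ fits sat
    with detour-remainder {R' = R'} x'≡X X≢Z sat
  ... | q , q⊑ , qX , qZ , sats with ⊨⋆-find R' sats qZ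
  ... | found with All.lookupAny fits found
  ... | fit , p₁ , p₁⊑q , sat₁ , Z∈p₁ =
    nothing≢just H₀Z (proj₂ (Fits-transfer (Any.lookup found) sat₁ (⊑-trans p₁⊑q q⊑) agree Z∈p₁ fit))
    where
    Z = eval z s
    H₀Z : H₀ Z ≡ nothing
    H₀Z = trans (H₀≐ Z) (trans (∪-nothing {X ↦ Y} {C} (↦-else (X≢Z ∘ sym))) CZ)
    agree : Agree p₁ H₀ (detour X Z Y ∪ C) Z
    agree c (_ , p₁c) c≢Z = trans (H₀≐ c) (trans (∪-nothing {X ↦ Y} {C} (↦-else c≢X))
                                     (sym (∪-nothing {detour X Z Y} {C} (detour-else c≢X c≢Z))))
      where
      c≢X : c ≢ X
      c≢X refl = nothing≢just qX (p₁⊑q c p₁c)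

  canon⋆-at : ∀ {s S Σ R a} → Pick S Σ R → Separated s Σ → Allocates s S a →
              canon⋆ s Σ a ≡ just (target s S)
  canon⋆-at {s} {S} {R = R} {a} p sep sa =
    trans (canon⋆-pick p sep sa a) (∪-just {a ↦ target s S} {canon⋆ s R} (↦-here a (target s S)))

  ⊨⋆-head-at : ∀ {s x' z R' h} → s , h ⊨⋆ next x' z ∷ R' → h (eval x' s) ≡ just (eval z s)
  ⊨⋆-head-at (_ , _ , sp , pts , _) = split-⊑ˡ sp _ (proj₁ pts)

  -- One of the heaps x ↦ y ∗ C and x ↦ z ↦ y ∗ C refutes lseg(x, z) ∗ R'; deciding which one
  -- requires deciding whether every conjunct of R' fits into the first.
  segments-countermodel : ∀ {s Σ̂ Σ R R' x y x' z} → Pick (lseg x y) Σ R → Separated s Σ →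
                          Allocated s Σ ⊆′ Allocated s Σ̂ → eval x s ≢ eval y s → eval x' s ≢ eval z s →
                          eval x' s ≡ eval x s → eval y s ≢ eval z s → ¬ Allocated s Σ̂ (eval z s) →
                          Countermodel s Σ̂ Σ (lseg x' z ∷ R')
  segments-countermodel {s} {Σ = Σ} {R} {R'} {x' = x'} {z} p sep Σ⊆Σ̂ x≢y x'≢z x'≡x y≢z z∉Σ̂
    with All.all? (fits? Σ sep) R'
  ... | no ¬fits = canonical-countermodel {Σ' = lseg x' z ∷ R'} sep λ (_ , _ , sp , _ , sats) →
    ¬fits (⊨⋆-fits R' sats (split-⊑ʳ sp))
  ... | yes fits =
    _ , detour-model p sep Σ⊆Σ̂ x≢y (y≢z ∘ sym) z∉Σ̂ ,
    detour-refutes {R' = R'} x'≡x (x'≢z ∘ trans x'≡x) (canon⋆-nothing R (z∉Σ̂ ∘ Σ⊆Σ̂ _ ∘ Allocated-pickʳ p))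
      (canon⋆-pick p sep (x≢y , refl)) fits

  colliding-countermodel : ∀ {s Σ̂ Σ R R'} T S' {a} → Pick T Σ R → Separated s Σ →
                           Allocated s Σ ⊆′ Allocated s Σ̂ → Allocates s T a → Allocates s S' a →
                           ¬ (s ⊨ₚ Guard Σ̂ T S') → Countermodel s Σ̂ Σ (S' ∷ R')
  colliding-countermodel emp _ _ _ _ () _ _
  colliding-countermodel (next _ _) emp _ _ _ _ () _
  colliding-countermodel (lseg _ _) emp _ _ _ _ () _
  colliding-countermodel {s} {Σ = Σ} {R' = R'} (next x y) (next x' z) p sep _ refl x'≡x ¬guard =
    canonical-countermodel {Σ' = next x' z ∷ R'} sep λ sat →
      ¬guard (Collides⇒Collide (next x y) (next x' z) (_ , refl , x'≡x) ,
              just-unique (canon⋆-at p sep refl)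
                          (subst (λ a → canon⋆ s Σ a ≡ just (eval z s)) x'≡x (⊨⋆-head-at {x' = x'} {z} {R'} sat)))
  colliding-countermodel (next x y) (lseg x' z) _ _ _ refl x'a ¬guard =
    ⊥-elim (¬guard (Collides⇒Collide (next x y) (lseg x' z) (_ , refl , x'a) , tt))
  colliding-countermodel {s} {Σ̂} {R = R} {R'} (lseg x y) (next x' z) p sep Σ⊆Σ̂ (x≢y , refl) x'≡x _ =
    _ , detour-model p sep Σ⊆Σ̂ x≢y (fresh-∉ vs (here refl) ∘ sym) m∉Σ̂ ,
    λ sat → fresh-∉ vs (there (here refl))
              (just-unique (subst (λ a → H a ≡ just (eval z s)) x'≡x (⊨⋆-head-at {x' = x'} {z} {R'} sat))
                           (∪-just {detour X m Y} {canon⋆ s R} (detour-x X m Y)))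
    where
    X = eval x s
    Y = eval y s
    vs = Y ∷ eval z s ∷ List.map (addr s) Σ̂
    m = fresh vs
    H = detour X m Y ∪ canon⋆ s R
    m∉Σ̂ : ¬ Allocated s Σ̂ m
    m∉Σ̂ m∈Σ̂ = fresh-∉ vs (there (there (Allocated⇒∈addrs Σ̂ m∈Σ̂))) refl
  colliding-countermodel {s} {Σ̂} (lseg x y) (lseg x' z) p sep Σ⊆Σ̂ (x≢y , refl) (x'≢z , x'≡x) ¬guard =
    segments-countermodel p sep Σ⊆Σ̂ x≢y x'≢z x'≡x y≢z z∉Σ̂
    where
    collide : s ⊨ₚ Collide (lseg x y) (lseg x' z)
    collide = Collides⇒Collide (lseg x y) (lseg x' z) (_ , (x≢y , refl) , (x'≢z , x'≡x))
    y≢z : eval y s ≢ eval z s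
    y≢z y≡z = ¬guard (collide , λ y≢z → ⊥-elim (y≢z y≡z))
    z∉Σ̂ : ¬ Allocated s Σ̂ (eval z s)
    z∉Σ̂ z∈Σ̂ = ¬guard (collide , λ _ → Allocated⇒Alloc Σ̂ z z∈Σ̂)

  leaf-countermodel : ∀ {s Σ̂} Σ Σ' → (∀ T → T ∈ Σ → ¬ (s ⊨ₚ Empty T)) → (∀ T → T ∈ Σ' → ¬ (s ⊨ₚ Empty T)) →
                      (∀ T T' → T ∈ Σ → T' ∈ Σ' → ¬ (s ⊨ₚ Guard Σ̂ T T')) → ¬ (s ⊨ₚ Final Σ Σ') →
                      Separated s Σ → Allocated s Σ ⊆′ Allocated s Σ̂ → Countermodel s Σ̂ Σ Σ'
  leaf-countermodel [] [] _ _ _ ¬final _ _ = ⊥-elim (¬final tt)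
  leaf-countermodel (T ∷ Σ) [] nonempty _ _ _ sep _ with ¬Empty⇒Allocates T (nonempty T (here refl))
  ... | a , ta = canonical-countermodel {Σ' = []} sep λ ε →
    nothing≢just (ε a) (proj₂ (⊨⋆-allocated (canon⋆-Sat (T ∷ Σ) sep) (here ta)))
  leaf-countermodel {s} Σ (S' ∷ R') _ nonempty' ¬guard _ sep Σ⊆Σ̂
    with ¬Empty⇒Allocates S' (nonempty' S' (here refl))
  ... | a , s'a with Allocated? s Σ a
  ...   | no a∉Σ = canonical-countermodel {Σ' = S' ∷ R'} sep λ (_ , _ , sp , sat' , _) →
    a∉Σ (canon⋆-dom Σ (split-⊑ˡ sp _ (proj₂ (Sat-allocates S' sat' s'a))))
  ...   | yes a∈Σ with Any⇒Pick a∈Σ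
  ...     | T , _ , p , ta = colliding-countermodel T S' p sep Σ⊆Σ̂ ta s'a (¬guard T S' (Pick⇒∈ p) (here refl))

  guard-countermodel : ∀ {s Σ̂ S S' Σ R Σ' R'} → Pick S Σ R → Pick S' Σ' R' → Separated s Σ →
                       Allocated s Σ ⊆′ Allocated s Σ̂ → ¬ (s ⊨ₚ Empty S) → s ⊨ₚ Guard Σ̂ S S' →
                       Countermodel s Σ̂ R (R' ++ Update S S' ∷ []) → Countermodel s Σ̂ Σ Σ'
  guard-countermodel {s} {Σ̂} {S} {S'} {Σ} {Σ' = Σ'} {R'} p p' sep Σ⊆Σ̂ ¬empty guard (hr , (satR , confR) , ¬satR')
    with ¬Empty⇒Allocates S ¬empty
  ... | a , sa = a ↦ t ∪ hr , (⊨⋆-pick⁺ p sp (Sat-cong S (canon-≐↦ S sa) (canon-Sat S)) satR , confined) , refute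
    where
    t = target s S
    hr-a : hr a ≡ nothing
    hr-a = [ (λ ra → ⊥-elim (apart⇒¬Allocated (proj₁ (Separated-pick p sep)) sa ra)) , id ]′
             (confR a (Σ⊆Σ̂ a (Allocated-pickˡ p sa)))
    sp : Split (a ↦ t ∪ hr) (a ↦ t) hr
    sp = split-∪ (↦-disjoint hr-a)
    confined : Confined s Σ̂ Σ (a ↦ t ∪ hr)
    confined v v∈Σ̂ with confR v v∈Σ̂ | v ℤ.≟ a
    ... | inj₁ rv | _ = inj₁ (Allocated-pickʳ p rv)
    ... | inj₂ _ | yes refl = inj₁ (Allocated-pickˡ p sa)
    ... | inj₂ hv | no v≢a = inj₂ (trans (∪-nothing {a ↦ t} {hr} (↦-else v≢a)) hv)
    refute : ¬ (s , a ↦ t ∪ hr ⊨⋆ Σ')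
    refute sat with ⊨⋆-pick⁻ p' sat
    ... | _ , q , spq , sat' , satsR'
      with Update-complete S S' guard sa sat' (split-⊑ˡ spq) (∪-just {a ↦ t} {hr} (↦-here a t))
    ... | r , sp₀ , satU with split-assocʳ spq sp₀
    ... | sp₁ , sp₂ = ¬satR' (⊨⋆-++⁺ R' (Update S S' ∷ []) sp-hr satsR' (⟦⟧⇒⊨⋆ (Update S S' ∷ []) satU))
      where
      sp-hr : Split hr q r
      sp-hr = split-cong (≐-sym (split-cancelˡ sp sp₁ (λ _ → refl))) (split-comm sp₂)

  complete : ∀ {s Σ̂ Σ Σ' U} → Match s Σ̂ Σ Σ' U → ¬ (s ⊨ₚ U) → Separated s Σ →
             Allocated s Σ ⊆′ Allocated s Σ̂ → Countermodel s Σ̂ Σ Σ'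
  complete (m1 p empty M) ¬u sep Σ⊆Σ̂
    with complete M (¬u ∘ (empty ,_)) (proj₂ (Separated-pick p sep)) (λ v → Σ⊆Σ̂ v ∘ Allocated-pickʳ p)
  ... | h , (sat , conf) , ¬sat' =
    h , (⊨⋆-pick-empty⁺ p empty sat , (λ v → Sum.map₁ (Allocated-pickʳ p) ∘ conf v)) , ¬sat'
  complete (m2 _ p' empty M) ¬u sep Σ⊆Σ̂ with complete M (¬u ∘ (empty ,_)) sep Σ⊆Σ̂
  ... | h , model , ¬sat' = h , model , ¬sat' ∘ ⊨⋆-pick-empty⁻ p' empty
  complete (m3 nonempty _ p p' guard M) ¬u sep Σ⊆Σ̂ =
    guard-countermodel p p' sep Σ⊆Σ̂ (nonempty _ (Pick⇒∈ p)) guard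
      (complete M (¬u ∘ (guard ,_)) (proj₂ (Separated-pick p sep)) (λ v → Σ⊆Σ̂ v ∘ Allocated-pickʳ p))
  complete (m4 {Σ₁ = Σ} {Σ'} nonempty nonempty' ¬guard) ¬final =
    leaf-countermodel Σ Σ' nonempty nonempty' ¬guard ¬final

  -- Precision and the main theorem

  LsegH-precise : ∀ {w a p q H} → LsegH w a p → LsegH w a q → p ⊑ H → q ⊑ H → p ≐ q
  LsegH-precise (done ε) l' _ _ c = trans (ε c) (sym (LsegH-empty refl l' c))
  LsegH-precise (step a≢w sp pts l) l' p⊑H q⊑H
    with LsegH-uncons-at a≢w l' q⊑H (p⊑H _ (split-⊑ˡ sp _ (proj₁ pts)))
  ... | _ , sp' , l'' =
    ≐-trans (split⇒≐∪ sp)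
      (≐-trans (∪-cong (PointsTo⇒≐↦ pts)
                       (LsegH-precise l l'' (⊑-trans (split-⊑ʳ sp) p⊑H) (⊑-trans (split-⊑ʳ sp') q⊑H)))
               (≐-sym (split⇒≐∪ sp')))

  Sat-precise : ∀ {s} S {p q H} → s , p ⊨ spat S → s , q ⊨ spat S → p ⊑ H → q ⊑ H → p ≐ q
  Sat-precise emp ε ε' _ _ c = trans (ε c) (sym (ε' c))
  Sat-precise (next _ _) pts pts' _ _ = ≐-trans (PointsTo⇒≐↦ pts) (≐-sym (PointsTo⇒≐↦ pts'))
  Sat-precise (lseg _ _) = LsegH-precise

  ⊨⋆-precise : ∀ {s} Σ {p q H} → s , p ⊨⋆ Σ → s , q ⊨⋆ Σ → p ⊑ H → q ⊑ H → p ≐ q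
  ⊨⋆-precise [] ε ε' _ _ c = trans (ε c) (sym (ε' c))
  ⊨⋆-precise (S ∷ Σ) (_ , _ , sp , sat , sats) (_ , _ , sp' , sat' , sats') p⊑H q⊑H =
    ≐-trans (split⇒≐∪ sp)
      (≐-trans (∪-cong (Sat-precise S sat sat' (⊑-trans (split-⊑ˡ sp) p⊑H) (⊑-trans (split-⊑ˡ sp') q⊑H))
                       (⊨⋆-precise Σ sats sats' (⊑-trans (split-⊑ʳ sp) p⊑H) (⊑-trans (split-⊑ʳ sp') q⊑H)))
               (≐-sym (split⇒≐∪ sp')))

  Separated-++⁻ : ∀ {s} Γ {Δ} → Separated s (Γ ++ Δ) →
                  Separated s Γ × Separated s Δ × (∀ {v} → Allocated s Γ v → ¬ Allocated s Δ v)
  Separated-++⁻ [] sep = [] , sep , λ ()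
  Separated-++⁻ (S ∷ Γ) (apart ∷ sep) with Separated-++⁻ Γ sep
  ... | sepΓ , sepΔ , cross =
    Allₚ.++⁻ˡ Γ apart ∷ sepΓ , sepΔ ,
    λ { (here sv) → apart⇒¬Allocated (Allₚ.++⁻ʳ Γ apart) sv ; (there v∈Γ) → cross v∈Γ }

  soundness : ∀ {s Σ̂ Σ Σ' R U} → Σ̂ ↭ Σ ++ R → Match s Σ̂ Σ Σ' U → Valid ((pure U ∧ ⟦ Σ̂ ⟧) ⇒ ⟦ R ++ Σ' ⟧)
  soundness {Σ̂ = Σ̂} {Σ} {Σ'} {R} perm M s' h (u , satΣ̂)
    with ⊨⋆-++⁻ Σ R (⊨⋆-resp-↭ perm (⟦⟧⇒⊨⋆ Σ̂ satΣ̂))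
  ... | hΣ , _ , sp , satΣ , satR = ⊨⋆⇒⟦⟧ (R ++ Σ') (⊨⋆-++⁺ R Σ' (split-comm sp) satR (sound M u satΣ confined))
    where
    confined : Confined s' Σ̂ Σ hΣ
    confined v v∈Σ̂ = Sum.map₂ (λ v∈R → split-apartˡ (split-comm sp) (proj₂ (⊨⋆-allocated satR v∈R)))
                               (Anyₚ.++⁻ Σ (Any-resp-↭ perm v∈Σ̂))

  completeness : ∀ {s Σ̂ Σ Σ' R U} → Σ̂ ↭ Σ ++ R → s ⊨ₚ WellFormed Σ̂ → Match s Σ̂ Σ Σ' U → ¬ (s ⊨ₚ U) →
                 ∃ λ h → s , h ⊨ ⟦ Σ̂ ⟧ × ¬ (s , h ⊨ ⟦ R ++ Σ' ⟧)
  completeness {s} {Σ̂} {Σ} {Σ'} {R} perm wf M ¬u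
    with Separated-++⁻ Σ (AllPairs-resp-↭ ¬Collides-sym perm (WellFormed⇒Separated Σ̂ wf))
  ... | sepΣ , sepR , cross with complete M ¬u sepΣ (λ _ → Any-resp-↭ (↭-sym perm) ∘ Anyₚ.++⁺ˡ)
  ... | hΣ , (satΣ , confΣ) , ¬satΣ' =
    hΣ ∪ canon⋆ s R , ⊨⋆⇒⟦⟧ Σ̂ (⊨⋆-resp-↭ (↭-sym perm) (⊨⋆-++⁺ Σ R sp satΣ satR)) , refute
    where
    satR : s , canon⋆ s R ⊨⋆ R
    satR = canon⋆-Sat R sepR
    disjoint : Disjoint hΣ (canon⋆ s R)
    disjoint v with canon⋆ s R v in e
    ... | nothing = inj₂ refl
    ... | just _ = inj₁ ([ (λ v∈Σ → ⊥-elim (cross v∈Σ (canon⋆-dom R e))) , id ]′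
                          (confΣ v (Any-resp-↭ (↭-sym perm) (Anyₚ.++⁺ʳ Σ (canon⋆-dom R e)))))
    sp = split-∪ disjoint
    refute : ¬ (s , hΣ ∪ canon⋆ s R ⊨ ⟦ R ++ Σ' ⟧)
    -- R is precise, so any split for R ∗ Σ' gives R exactly the canonical part.
    refute sat with ⊨⋆-++⁻ R Σ' (⟦⟧⇒⊨⋆ (R ++ Σ') sat)
    ... | _ , _ , sp' , satR' , satΣ' =
      ¬satΣ' (⊨⋆-cong Σ' (split-cancelˡ sp' (split-comm sp)
                            (⊨⋆-precise R satR' satR (split-⊑ˡ sp') (split-⊑ʳ sp))) satΣ')

proposition6 : (L : PureLang) → let open SL L in
    (s : Stack) (Σ̂ Σ₁ Σ' R : SpConj) → Σ̂ ↭ Σ₁ ++ R →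
    s ⊨ₚ WellFormed Σ̂ →
    (U : PF) → Match s Σ̂ Σ₁ Σ' U →
    ((s ⊨ₚ U) → Valid ((pure U ∧ ⟦ Σ̂ ⟧) ⇒ ⟦ R ++ Σ' ⟧))
    × (¬ (s ⊨ₚ U) → ∃ λ (h : Heap) → (s , h ⊨ ⟦ Σ̂ ⟧) × ¬ (s , h ⊨ ⟦ R ++ Σ' ⟧))
-- Part (i) holds without the hypothesis s ⊨ U.
proposition6 L s Σ̂ Σ₁ Σ' R perm wf U M = (λ _ → soundness perm M) , completeness perm wf M
  where open Matching L
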